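{- If $T$ is a (finite) tree, then $\mathrm{MOF}(T) = \alpha(T)$.
   Context: An orientation $D$ of a simple graph $G$ assigns to each edge exactly one direction; if $(u,v)$ is an arc, $v$ is an out-neighbor of $u$. Oriented $1$-forcing: starting from a nonempty set $S$ of colored vertices, repeatedly, any colored vertex with at most one non-colored out-neighbor forces that out-neighbor to become colored (all forcings in a step simultaneous), until no change occurs; $S$ is a forcing set if all vertices end up colored. $F(D)$ is the minimum size of a forcing set of $D$, and $\mathrm{MOF}(G)$ is the maximum of $F(D)$ over all orientations $D$ of $G$. $\alpha(T)$ is the independence number of $T$. -}

module Defs where

open import Data.Nat using (ℕ; zero; suc; _≤_; _≤ᵇ_)
open import Data.Bool using (Bool; true; false; _∧_; _∨_; not; if_then_else_)
open import Data.Fin using (Fin; zero; suc; inject₁; fromℕ)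
open import Data.List using (List; filter; length; allFin)
open import Data.Bool.ListAction using (any)
open import Data.Product using (Σ; ∃; _×_; _,_)
open import Data.Sum using (_⊎_)
open import Function.Definitions using (Injective)
open import Relation.Binary.PropositionalEquality using (_≡_)
open import Relation.Nullary using (¬_)

record Graph (n : ℕ) : Set where
  field
    Adj   : Fin n → Fin n → Bool
    sym   : ∀ u v → Adj u v ≡ Adj v u
    irrefl : ∀ v → Adj v v ≡ false
open Graph public

VSet : ℕ → Set
VSet n = Fin n → Bool

count : ∀ {n} → VSet n → ℕ
count {n} S = length (filter (λ v → S v Data.Bool.≟ true) (allFin n))
  where import Data.Bool

data Reach {n} (G : Graph n) : Fin n → Fin n → Set where
  here : ∀ {v} → Reach G v v
  step : ∀ {u w v} → Adj G u w ≡ true → Reach G w v → Reach G u v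

Connected : ∀ {n} → Graph n → Set
Connected {n} G = ∀ (u v : Fin n) → Reach G u v

record Cycle {n} (G : Graph n) : Set where
  field
    k     : ℕ
    c     : Fin (suc (suc (suc k))) → Fin n
    inj   : Injective _≡_ _≡_ c
    edges : ∀ (i : Fin (suc (suc k))) → Adj G (c (inject₁ i)) (c (suc i)) ≡ true
    close : Adj G (c (fromℕ (suc (suc k)))) (c zero) ≡ true

Acyclic : ∀ {n} → Graph n → Set
Acyclic G = ¬ Cycle G

IsTree : ∀ {n} → Graph n → Set
IsTree {n} G = (1 ≤ n) × Connected G × Acyclic G

Digraph : ℕ → Set
Digraph n = Fin n → Fin n → Bool

IsOrientation : ∀ {n} → Graph n → Digraph n → Set
IsOrientation {n} G D =
  (∀ (u v : Fin n) → D u v ≡ true → Adj G u v ≡ true) ×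
  (∀ (u v : Fin n) → Adj G u v ≡ true →
     (D u v ≡ true × D v u ≡ false) ⊎ (D u v ≡ false × D v u ≡ true))

uncoloredOut : ∀ {n} → Digraph n → VSet n → Fin n → ℕ
uncoloredOut D C u = count (λ w → D u w ∧ not (C w))

forceStep : ∀ {n} → Digraph n → VSet n → VSet n
forceStep {n} D C v =
  C v ∨ any (λ u → C u ∧ D u v ∧ (uncoloredOut D C u ≤ᵇ 1)) (allFin n)

iterate : ∀ {n} → ℕ → Digraph n → VSet n → VSet n
iterate zero    D C = C
iterate (suc k) D C = forceStep D (iterate k D C)

-- S is a forcing set: nonempty, and the process eventually colors every vertex
-- (the process is monotone, so this is the same as the stable final set being
-- everything).
IsForcingSet : ∀ {n} → Digraph n → VSet n → Set
IsForcingSet {n} D S =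
  (1 ≤ count S) × ∃ λ k → ∀ (v : Fin n) → iterate k D S v ≡ true

IsForcingNumber : ∀ {n} → Digraph n → ℕ → Set
IsForcingNumber {n} D m =
  (∃ λ (S : VSet n) → IsForcingSet D S × count S ≡ m) ×
  (∀ (S : VSet n) → IsForcingSet D S → m ≤ count S)

IsMOF : ∀ {n} → Graph n → ℕ → Set
IsMOF {n} G m =
  (∃ λ (D : Digraph n) → IsOrientation G D × IsForcingNumber D m) ×
  (∀ (D : Digraph n) → IsOrientation G D → ∀ k → IsForcingNumber D k → k ≤ m)

IsIndependent : ∀ {n} → Graph n → VSet n → Set
IsIndependent {n} G S =
  ∀ (u v : Fin n) → S u ≡ true → S v ≡ true → Adj G u v ≡ false

IsIndependenceNumber : ∀ {n} → Graph n → ℕ → Set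
IsIndependenceNumber {n} G a =
  (∃ λ (S : VSet n) → IsIndependent G S × count S ≡ a) ×
  (∀ (S : VSet n) → IsIndependent G S → count S ≤ a)

-- Orient every edge away from a maximum independent set I (rank the vertices of I
-- first). Each vertex of I is then a source, sources are never forced, so every
-- forcing set contains I and F(D) ≥ α.
--
-- Conversely, let D orient a forest and take a vertex x of degree ≤ 1 in the part
-- still to be handled. If x is isolated it joins both the seeds and the
-- independent set. If x has a unique neighbour y, remove x and y, put x into the
-- independent set and the tail of the arc xy into the seeds: once everything
-- else is colored, that tail forces the head. So every orientation has a forcing
-- set no larger than an independent set, i.e. F(D) ≤ α.
module Submission where

open import Data.Bool using (Bool; true; false; _∧_; _∨_; not; T; if_then_else_)
open import Data.Bool.ListAction using (any)
open import Data.Bool.Properties using (∨-zeroʳ; ∨-identityʳ; ∧-zeroʳ; ¬-not; T-≡; T-∧) renaming (_≟_ to _≟B_)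
open import Data.Empty using (⊥; ⊥-elim)
open import Data.Fin using (Fin; zero; suc; toℕ; inject₁; fromℕ; fromℕ<) renaming (_≟_ to _≟F_)
open import Data.Fin.Properties using (toℕ-injective; toℕ<n; toℕ-inject₁; toℕ-fromℕ; toℕ-fromℕ<; pigeonhole; any?; all?) renaming (suc-injective to Fin-suc-injective)
open import Data.Fin.Subset using (Subset)
open import Data.Fin.Subset.Properties using (anySubset?)
open import Data.List using (filter; length; allFin; tabulate)
open import Data.List.Membership.Propositional.Properties using (∈-allFin)
import Data.List.Relation.Unary.Any as Any
open import Data.List.Relation.Unary.Any.Properties using (any⁺; any⁻)
open import Data.Nat
open import Data.Nat.Induction using (<-rec)
open import Data.Nat.Properties
open import Data.Product using (Σ; ∃; _×_; _,_; proj₁; proj₂)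
open import Data.Sum using (_⊎_; inj₁; inj₂; [_,_]′)
open import Data.Vec using (lookup) renaming (tabulate to tabulateᵥ)
open import Data.Vec.Properties using (lookup∘tabulate)
open import Function using (_∘_; id; case_of_)
open import Function.Bundles using (Equivalence)
open import Relation.Binary.Definitions using (tri<; tri≈; tri>)
open import Relation.Binary.PropositionalEquality
open import Relation.Nullary using (¬_; Dec; yes; no; does)
open import Relation.Nullary.Decidable using (_×-dec_; _→-dec_; ¬?)

open import Defs renaming (sym to Adj-sym)

private variable
  n : ℕ

_⊆_ : VSet n → VSet n → Set
S ⊆ T = ∀ w → S w ≡ true → T w ≡ true

∅ : VSet n
∅ _ = false

full : VSet n
full _ = true

insert : Fin n → VSet n → VSet n
insert x S w = S w ∨ does (w ≟F x)

remove : Fin n → VSet n → VSet n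
remove x S w = S w ∧ not (does (w ≟F x))

bit : Bool → ℕ
bit true = 1
bit false = 0

card : VSet n → ℕ
card {zero} S = 0
card {suc n} S = bit (S zero) + card (S ∘ suc)

count≡card : (S : VSet n) → count S ≡ card S
count≡card S = go id S
  where
  go : ∀ {k m} (f : Fin k → Fin m) (S : VSet m) →
    length (filter (λ v → S v ≟B true) (tabulate f)) ≡ card (S ∘ f)
  go {zero} f S = refl
  go {suc k} f S with S (f zero)
  ... | true = cong suc (go (f ∘ suc) S)
  ... | false = go (f ∘ suc) S

bit≤1 : ∀ b → bit b ≤ 1
bit≤1 true = ≤-refl
bit≤1 false = z≤n

bit-mono : ∀ {a b} → (a ≡ true → b ≡ true) → bit a ≤ bit b
bit-mono {true} h rewrite h refl = ≤-refl
bit-mono {false} h = z≤n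

card≤n : (S : VSet n) → card S ≤ n
card≤n {zero} S = z≤n
card≤n {suc n} S = +-mono-≤ (bit≤1 (S zero)) (card≤n (S ∘ suc))

card-cong : (S T : VSet n) → (∀ w → S w ≡ T w) → card S ≡ card T
card-cong {zero} S T eq = refl
card-cong {suc n} S T eq = cong₂ _+_ (cong bit (eq zero)) (card-cong (S ∘ suc) (T ∘ suc) (eq ∘ suc))

card-mono : (S T : VSet n) → S ⊆ T → card S ≤ card T
card-mono {zero} S T S⊆T = z≤n
card-mono {suc n} S T S⊆T = +-mono-≤ (bit-mono (S⊆T zero)) (card-mono (S ∘ suc) (T ∘ suc) (S⊆T ∘ suc))

count-mono : (S T : VSet n) → S ⊆ T → count S ≤ count T
count-mono S T S⊆T = subst₂ _≤_ (sym (count≡card S)) (sym (count≡card T)) (card-mono S T S⊆T)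

card-∅ : card (∅ {n}) ≡ 0
card-∅ {zero} = refl
card-∅ {suc n} = card-∅ {n}

card-pos : (S : VSet n) → ∀ x → S x ≡ true → 1 ≤ card S
card-pos S zero Sx rewrite Sx = s≤s z≤n
card-pos S (suc x) Sx = ≤-trans (card-pos (S ∘ suc) x Sx) (m≤n+m _ (bit (S zero)))

card-mono-< : (S T : VSet n) → S ⊆ T → ∀ x → S x ≡ false → T x ≡ true → card S < card T
card-mono-< S T S⊆T zero Sx Tx rewrite Sx | Tx = s≤s (card-mono (S ∘ suc) (T ∘ suc) (S⊆T ∘ suc))
card-mono-< S T S⊆T (suc x) Sx Tx = begin-strict
  bit (S zero) + card (S ∘ suc) <⟨ +-mono-≤-< (bit-mono (S⊆T zero)) (card-mono-< (S ∘ suc) (T ∘ suc) (S⊆T ∘ suc) x Sx Tx) ⟩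
  bit (T zero) + card (T ∘ suc) ∎
  where open ≤-Reasoning

card-≤-suc : (S T : VSet n) → ∀ x → (∀ w → w ≢ x → S w ≡ true → T w ≡ true) → card S ≤ suc (card T)
card-≤-suc S T zero h =
  +-mono-≤ (bit≤1 (S zero)) (≤-trans (card-mono (S ∘ suc) (T ∘ suc) (λ w → h (suc w) λ ())) (m≤n+m _ (bit (T zero))))
card-≤-suc S T (suc x) h = begin
  bit (S zero) + card (S ∘ suc)       ≤⟨ +-mono-≤ (bit-mono (h zero λ ())) (card-≤-suc (S ∘ suc) (T ∘ suc) x (λ w w≢x → h (suc w) (w≢x ∘ Fin-suc-injective))) ⟩
  bit (T zero) + suc (card (T ∘ suc)) ≡⟨ +-suc (bit (T zero)) _ ⟩
  suc (card T)                        ∎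
  where open ≤-Reasoning

insert-self : (x : Fin n) (S : VSet n) → insert x S x ≡ true
insert-self x S with x ≟F x
... | yes _ = ∨-zeroʳ (S x)
... | no x≢x = ⊥-elim (x≢x refl)

insert-⊇ : (x : Fin n) (S : VSet n) → S ⊆ insert x S
insert-⊇ x S w Sw rewrite Sw = refl

insert-cases : (x : Fin n) (S : VSet n) → ∀ w → insert x S w ≡ true → S w ≡ true ⊎ w ≡ x
insert-cases x S w ins with w ≟F x
... | yes w≡x = inj₂ w≡x
... | no _ = inj₁ (trans (sym (∨-identityʳ (S w))) ins)

remove-⊆ : (x : Fin n) (U : VSet n) → remove x U ⊆ U
remove-⊆ x U w rem with U w
... | true = refl
... | false with () ← rem

remove-≢ : (x : Fin n) (U : VSet n) → ∀ w → remove x U w ≡ true → w ≢ x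
remove-≢ x U w rem w≡x with w ≟F x
... | no w≢x = w≢x w≡x
... | yes _ with () ← trans (sym (∧-zeroʳ (U w))) rem

remove-keeps : (x : Fin n) (U : VSet n) → ∀ w → U w ≡ true → w ≢ x → remove x U w ≡ true
remove-keeps x U w Uw w≢x with w ≟F x
... | yes w≡x = ⊥-elim (w≢x w≡x)
... | no _ rewrite Uw = refl

remove-self : (x : Fin n) (U : VSet n) → remove x U x ≡ false
remove-self x U = ¬-not (λ rem → remove-≢ x U x rem refl)

remove-out : (x : Fin n) (U : VSet n) → ∀ w → U w ≡ true → remove x U w ≡ false → w ≡ x
remove-out x U w Uw rem with w ≟F x
... | yes w≡x = w≡x
... | no _ rewrite Uw with () ← rem

card-insert : (x : Fin n) (S : VSet n) → card (insert x S) ≤ suc (card S)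
card-insert x S = card-≤-suc (insert x S) S x λ w w≢x ins → case insert-cases x S w ins of λ
  { (inj₁ Sw) → Sw
  ; (inj₂ w≡x) → ⊥-elim (w≢x w≡x) }

card-insert-fresh : (x : Fin n) (S : VSet n) → S x ≡ false → suc (card S) ≤ card (insert x S)
card-insert-fresh x S Sx = card-mono-< S (insert x S) (insert-⊇ x S) x Sx (insert-self x S)

card-remove : (x : Fin n) (U : VSet n) → U x ≡ true → suc (card (remove x U)) ≤ card U
card-remove x U Ux = card-mono-< (remove x U) U (remove-⊆ x U) x (remove-self x U) Ux

-- Forcing inside the subdigraph induced by U, as derivation trees instead of
-- rounds of simultaneous forcing.
data Forced (D : Digraph n) (U S : VSet n) : Fin n → Set where
  seed  : ∀ {v} → S v ≡ true → Forced D U S v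
  force : ∀ {u v} → Forced D U S u → D u v ≡ true → U v ≡ true →
          (∀ w → U w ≡ true → D u w ≡ true → w ≢ v → Forced D U S w) → Forced D U S v

module _ {D : Digraph n} where

  Forced-seed : ∀ {U S v} → Forced D U S v → ∃ λ u → S u ≡ true
  Forced-seed (seed Sv) = _ , Sv
  Forced-seed (force Fu _ _ _) = Forced-seed Fu

  Forced-∈ : ∀ {U S v} → S ⊆ U → Forced D U S v → U v ≡ true
  Forced-∈ S⊆U (seed Sv) = S⊆U _ Sv
  Forced-∈ S⊆U (force _ _ Uv _) = Uv

  Forced-lift : ∀ {U U′ S S′} → U′ ⊆ U → S′ ⊆ S →
    (∀ w u → U w ≡ true → U′ w ≡ false → Forced D U′ S′ u → D u w ≡ true → Forced D U S w) →
    ∀ {v} → Forced D U′ S′ v → Forced D U S v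
  Forced-lift U′⊆U S′⊆S outside (seed S′v) = seed (S′⊆S _ S′v)
  Forced-lift {U} {U′} {S} U′⊆U S′⊆S outside (force {u} {v} Fu Duv U′v others) =
    force (Forced-lift U′⊆U S′⊆S outside Fu) Duv (U′⊆U v U′v) others′
    where
    others′ : ∀ w → U w ≡ true → D u w ≡ true → w ≢ v → Forced D U S w
    others′ w Uw Duw w≢v with U′ w in U′w
    ... | true = Forced-lift U′⊆U S′⊆S outside (others w U′w Duw w≢v)
    ... | false = outside w u Uw U′w Fu Duw

iterate-mono : (D : Digraph n) (S : VSet n) → ∀ {k k′} → k ≤ k′ → ∀ v →
  iterate k D S v ≡ true → iterate k′ D S v ≡ true
iterate-mono D S {k} {zero} z≤n v Cv = Cv
iterate-mono D S {k} {suc k′} k≤k′ v Cv with m≤n⇒m<n∨m≡n k≤k′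
... | inj₂ refl = Cv
... | inj₁ k<k′ rewrite iterate-mono D S (s≤s⁻¹ k<k′) v Cv = refl

uniformBound : (P : ℕ → Fin n → Set) → (∀ {k k′} → k ≤ k′ → ∀ w → P k w → P k′ w) →
  (∀ w → ∃ λ k → P k w) → ∃ λ K → ∀ w → P K w
uniformBound {zero} P mono bound = 0 , λ ()
uniformBound {suc n} P mono bound with bound zero | uniformBound (λ k → P k ∘ suc) (λ k≤k′ → mono k≤k′ ∘ suc) (bound ∘ suc)
... | k₀ , P₀ | K , Pₛ = k₀ ⊔ K , λ
  { zero → mono (m≤m⊔n k₀ K) zero P₀
  ; (suc w) → mono (m≤n⊔m k₀ K) (suc w) (Pₛ w) }

forceStep-fires : (D : Digraph n) (C : VSet n) {u v : Fin n} → C u ≡ true → D u v ≡ true →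
  (∀ w → D u w ≡ true → w ≢ v → C w ≡ true) → forceStep D C v ≡ true
forceStep-fires {n} D C {u} {v} Cu Duv others =
  trans (cong (C v ∨_) (Equivalence.to T-≡ (any⁺ fires (Any.map fires-u (∈-allFin u))))) (∨-zeroʳ (C v))
  where
  fires : Fin n → Bool
  fires u′ = C u′ ∧ D u′ v ∧ (uncoloredOut D C u′ ≤ᵇ 1)
  one-uncolored : uncoloredOut D C u ≤ 1
  one-uncolored = begin
    uncoloredOut D C u ≡⟨ count≡card (λ w → D u w ∧ not (C w)) ⟩
    card (λ w → D u w ∧ not (C w)) ≤⟨ card-≤-suc _ ∅ v colored ⟩
    suc (card (∅ {n}))             ≡⟨ cong suc (card-∅ {n}) ⟩
    1 ∎
    where
    open ≤-Reasoning
    colored : ∀ w → w ≢ v → (D u w ∧ not (C w)) ≡ true → false ≡ true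
    colored w w≢v uncol with D u w in Duw
    ... | true rewrite others w Duw w≢v = uncol
  fires-u : ∀ {u′} → u ≡ u′ → T (fires u′)
  fires-u refl rewrite Cu | Duv = ≤⇒≤ᵇ one-uncolored

Forced-iterate : (D : Digraph n) (S : VSet n) → ∀ {v} → Forced D full S v → ∃ λ k → iterate k D S v ≡ true
Forced-iterate D S (seed Sv) = 0 , Sv
Forced-iterate {n} D S {v} (force {u} Fu Duv _ others)
  with Forced-iterate D S Fu | uniformBound P P-mono P-bound
  where
  P : ℕ → Fin n → Set
  P k w = D u w ≡ true → w ≢ v → iterate k D S w ≡ true
  P-mono : ∀ {k k′} → k ≤ k′ → ∀ w → P k w → P k′ w
  P-mono k≤k′ w Pw Duw w≢v = iterate-mono D S k≤k′ w (Pw Duw w≢v)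
  P-bound : ∀ w → ∃ λ k → P k w
  P-bound w with D u w in Duw | w ≟F v
  ... | false | _ = 0 , λ ()
  ... | true | yes refl = 0 , λ _ v≢v → ⊥-elim (v≢v refl)
  ... | true | no w≢v = let k , Ck = Forced-iterate D S (others w refl Duw w≢v) in k , λ _ _ → Ck
... | kᵤ , Cu | K , Cothers = suc (kᵤ ⊔ K) ,
  forceStep-fires D _ (iterate-mono D S (m≤m⊔n kᵤ K) u Cu) Duv
    λ w Duw w≢v → iterate-mono D S (m≤n⊔m kᵤ K) w (Cothers w Duw w≢v)

Forced⇒IsForcingSet : (D : Digraph n) (S : VSet n) → Fin n → (∀ v → Forced D full S v) → IsForcingSet D S
Forced⇒IsForcingSet D S v₀ forced =
  subst (1 ≤_) (sym (count≡card S)) (card-pos S _ (proj₂ (Forced-seed (forced v₀)))) ,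
  uniformBound (λ k v → iterate k D S v ≡ true) (iterate-mono D S) (λ v → Forced-iterate D S (forced v))

iterate-source : (D : Digraph n) (S : VSet n) → ∀ {v} → (∀ u → D u v ≡ false) → ∀ k → iterate k D S v ≡ S v
iterate-source D S src zero = refl
iterate-source {n} D S {v} src (suc k) =
  trans (cong₂ _∨_ (iterate-source D S src k) (¬-not no-forcer)) (∨-identityʳ (S v))
  where
  C = iterate k D S
  no-forcer : any (λ u → C u ∧ D u v ∧ (uncoloredOut D C u ≤ᵇ 1)) (allFin n) ≢ true
  no-forcer fires with Any.satisfied (any⁻ _ (allFin n) (Equivalence.from T-≡ fires))
  ... | u , t = subst T (src u) (proj₁ (Equivalence.to (T-∧ {D u v}) (proj₂ (Equivalence.to (T-∧ {C u}) t))))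

forcingSet-⊇-sources : (D : Digraph n) (S : VSet n) → IsForcingSet D S → ∀ v → (∀ u → D u v ≡ false) → S v ≡ true
forcingSet-⊇-sources D S (_ , k , colored) v src = trans (sym (iterate-source D S src k)) (colored v)

byRank : Graph n → (Fin n → ℕ) → Digraph n
byRank G r u v = Adj G u v ∧ (r u <ᵇ r v)

byRank-isOrientation : (G : Graph n) (r : Fin n → ℕ) → (∀ u v → r u ≡ r v → u ≡ v) → IsOrientation G (byRank G r)
byRank-isOrientation G r r-injective = arcs-are-edges , one-direction
  where
  arcs-are-edges : ∀ u v → byRank G r u v ≡ true → Adj G u v ≡ true
  arcs-are-edges u v arc with Adj G u v
  ... | true = refl
  one-direction : ∀ u v → Adj G u v ≡ true →
    (byRank G r u v ≡ true × byRank G r v u ≡ false) ⊎ (byRank G r u v ≡ false × byRank G r v u ≡ true)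
  one-direction u v uv rewrite uv | trans (Adj-sym G v u) uv with <-cmp (r u) (r v)
  ... | tri< u<v _ v≮u = inj₁ (Equivalence.to T-≡ (<⇒<ᵇ u<v) , ¬-not (v≮u ∘ <ᵇ⇒< _ _ ∘ Equivalence.from T-≡))
  ... | tri> u≮v _ v<u = inj₂ (¬-not (u≮v ∘ <ᵇ⇒< _ _ ∘ Equivalence.from T-≡) , Equivalence.to T-≡ (<⇒<ᵇ v<u))
  ... | tri≈ _ ru≡rv _ with refl ← r-injective u v ru≡rv with () ← trans (sym uv) (irrefl G u)

byRank-source : (G : Graph n) (r : Fin n → ℕ) → ∀ v → (∀ u → Adj G u v ≡ true → r v < r u) → ∀ u → byRank G r u v ≡ false
byRank-source G r v lowest u with Adj G u v in uv
... | false = refl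
... | true = ¬-not (<⇒≱ (lowest u uv) ∘ <⇒≤ ∘ <ᵇ⇒< _ _ ∘ Equivalence.from T-≡)

independentFirst : VSet n → Fin n → ℕ
independentFirst {n} I u = (if I u then 0 else n) + toℕ u

independentFirst-injective : (I : VSet n) → ∀ u v → independentFirst I u ≡ independentFirst I v → u ≡ v
independentFirst-injective {n} I u v eq with I u | I v
... | true | true = toℕ-injective eq
... | false | false = toℕ-injective (+-cancelˡ-≡ n _ _ eq)
... | true | false = ⊥-elim (<⇒≱ (toℕ<n u) (subst (n ≤_) (sym eq) (m≤m+n n _)))
... | false | true = ⊥-elim (<⇒≱ (toℕ<n v) (subst (n ≤_) eq (m≤m+n n _)))

independent⊆forcingSet : (G : Graph n) (I : VSet n) → IsIndependent G I →
  ∀ S → IsForcingSet (byRank G (independentFirst I)) S → I ⊆ S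
independent⊆forcingSet {n} G I independent S forcing v Iv =
  forcingSet-⊇-sources _ S forcing v (byRank-source G _ v lowest)
  where
  lowest : ∀ u → Adj G u v ≡ true → independentFirst I v < independentFirst I u
  lowest u uv with I u in Iu
  ... | true with () ← trans (sym uv) (independent u v Iu Iv)
  ... | false rewrite Iv = <-≤-trans (toℕ<n v) (m≤m+n n _)

Degree≤1 : Graph n → VSet n → Fin n → Set
Degree≤1 G U x = ∀ w₁ w₂ → U w₁ ≡ true → U w₂ ≡ true → Adj G x w₁ ≡ true → Adj G x w₂ ≡ true → w₁ ≡ w₂

module NonBacktrackingWalk (G : Graph n) (acyclic : Acyclic G) (v : ℕ → Fin n)
  (adjacent : ∀ t → Adj G (v t) (v (suc t)) ≡ true)
  (nonBacktracking : ∀ t → v (suc (suc t)) ≢ v t) where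

  DistinctBefore : ℕ → Set
  DistinctBefore j = ∀ p q → q < j → p < q → v p ≢ v q

  -- A closed stretch of length 1 is a loop, of length 2 a backtrack, and longer ones are cycles.
  closed⇒⊥ : ∀ i d → v i ≡ v (i + suc d) → DistinctBefore (i + suc d) → ⊥
  closed⇒⊥ i zero closed _ with () ←
    trans (sym (irrefl G (v i))) (subst (λ w → Adj G (v i) w ≡ true) (sym (trans closed (cong v (+-comm i 1)))) (adjacent i))
  closed⇒⊥ i (suc zero) closed _ = nonBacktracking i (sym (trans closed (cong v (+-comm i 2))))
  closed⇒⊥ i (suc (suc k)) closed distinct = acyclic record
    { k = k ; c = c ; inj = c-injective ; edges = edges ; close = close }
    where
    c : Fin (suc (suc (suc k))) → Fin n
    c t = v (i + toℕ t)
    c-injective : ∀ {t₁ t₂} → c t₁ ≡ c t₂ → t₁ ≡ t₂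
    c-injective {t₁} {t₂} eq with <-cmp (toℕ t₁) (toℕ t₂)
    ... | tri≈ _ t₁≡t₂ _ = toℕ-injective t₁≡t₂
    ... | tri< t₁<t₂ _ _ = ⊥-elim (distinct _ _ (+-monoʳ-< i (toℕ<n t₂)) (+-monoʳ-< i t₁<t₂) eq)
    ... | tri> _ _ t₂<t₁ = ⊥-elim (distinct _ _ (+-monoʳ-< i (toℕ<n t₁)) (+-monoʳ-< i t₂<t₁) (sym eq))
    edges : ∀ (t : Fin (suc (suc k))) → Adj G (c (inject₁ t)) (c (suc t)) ≡ true
    edges t rewrite toℕ-inject₁ t | +-suc i (toℕ t) = adjacent (i + toℕ t)
    close : Adj G (c (fromℕ (suc (suc k)))) (c zero) ≡ true
    close rewrite toℕ-fromℕ (suc (suc k)) | +-identityʳ i | closed | +-suc i (suc (suc k)) = adjacent (i + suc (suc k))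

  noRepeat : ∀ j (i : Fin j) → v (toℕ i) ≢ v j
  noRepeat = <-rec (λ j → (i : Fin j) → v (toℕ i) ≢ v j) go
    where
    go : ∀ j → (∀ {j′} → j′ < j → (i : Fin j′) → v (toℕ i) ≢ v j′) → (i : Fin j) → v (toℕ i) ≢ v j
    go j earlier i repeat with any? (λ (q : Fin j) → any? (λ (p : Fin (toℕ q)) → v (toℕ p) ≟F v (toℕ q)))
    ... | yes (q , p , repeat′) = earlier (toℕ<n q) p repeat′
    ... | no none = closed⇒⊥ (toℕ i) (j ∸ suc (toℕ i))
          (trans repeat (cong v (sym i+d≡j))) (subst DistinctBefore (sym i+d≡j) distinct)
      where
      i+d≡j : toℕ i + suc (j ∸ suc (toℕ i)) ≡ j
      i+d≡j = trans (+-suc (toℕ i) _) (m+[n∸m]≡n (toℕ<n i))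
      distinct : DistinctBefore j
      distinct p q q<j p<q eq = none (fromℕ< q<j , fromℕ< (subst (p <_) (sym (toℕ-fromℕ< q<j)) p<q) ,
        trans (cong v (toℕ-fromℕ< _)) (trans eq (cong v (sym (toℕ-fromℕ< q<j)))))

  impossible : ⊥
  impossible with pigeonhole (n<1+n n) (λ (t : Fin (suc n)) → v (toℕ t))
  ... | i , j , i<j , repeat = noRepeat (toℕ j) (fromℕ< i<j) (trans (cong v (toℕ-fromℕ< i<j)) repeat)

leaf : (G : Graph n) → Acyclic G → (U : VSet n) → ∀ u₀ → U u₀ ≡ true → ∃ λ x → U x ≡ true × Degree≤1 G U x
leaf {n} G acyclic U u₀ Uu₀ with any? (λ x → (U x ≟B true) ×-dec Degree≤1? x)
  where
  Degree≤1? : ∀ x → Dec (Degree≤1 G U x)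
  Degree≤1? x = all? λ w₁ → all? λ w₂ →
    (U w₁ ≟B true) →-dec (U w₂ ≟B true) →-dec (Adj G x w₁ ≟B true) →-dec (Adj G x w₂ ≟B true) →-dec (w₁ ≟F w₂)
... | yes found = found
... | no noLeaf = ⊥-elim (NonBacktrackingWalk.impossible G acyclic v adjacent nonBacktracking)
  where
  escape : ∀ p c → U c ≡ true → ∃ λ w → U w ≡ true × Adj G c w ≡ true × w ≢ p
  escape p c Uc with any? (λ w → (U w ≟B true) ×-dec (Adj G c w ≟B true) ×-dec ¬? (w ≟F p))
  ... | yes found = found
  ... | no none = ⊥-elim (noLeaf (c , Uc , λ w₁ w₂ U₁ U₂ A₁ A₂ → trans (only-p w₁ U₁ A₁) (sym (only-p w₂ U₂ A₂))))
    where
    only-p : ∀ w → U w ≡ true → Adj G c w ≡ true → w ≡ p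
    only-p w Uw cw with w ≟F p
    ... | yes w≡p = w≡p
    ... | no w≢p = ⊥-elim (none (w , Uw , cw , w≢p))
  walk : ℕ → (Σ (Fin n) λ c → U c ≡ true) × Fin n
  walk zero = (u₀ , Uu₀) , u₀
  walk (suc t) with walk t
  ... | (c , Uc) , p with escape p c Uc
  ... | w , Uw , _ = (w , Uw) , c
  v : ℕ → Fin n
  v t = proj₁ (proj₁ (walk t))
  adjacent : ∀ t → Adj G (v t) (v (suc t)) ≡ true
  adjacent t with walk t
  ... | (c , Uc) , p with escape p c Uc
  ... | _ , _ , cw , _ = cw
  nonBacktracking : ∀ t → v (suc (suc t)) ≢ v t
  nonBacktracking t with walk t
  ... | (c , Uc) , p with escape p c Uc
  ... | w , Uw , _ with escape c w Uw
  ... | _ , _ , _ , w′≢c = w′≢c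

insert-independent : (G : Graph n) (J : VSet n) → IsIndependent G J →
  ∀ x → (∀ w → J w ≡ true → Adj G x w ≡ false) → IsIndependent G (insert x J)
insert-independent G J independent x apart u v Ju Jv
  with insert-cases x J u Ju | insert-cases x J v Jv
... | inj₁ Ju′ | inj₁ Jv′ = independent u v Ju′ Jv′
... | inj₂ refl | inj₁ Jv′ = apart v Jv′
... | inj₁ Ju′ | inj₂ refl = trans (Adj-sym G u x) (apart u Ju′)
... | inj₂ refl | inj₂ refl = irrefl G u

module ForestBound (G : Graph n) (acyclic : Acyclic G) (D : Digraph n) (orientation : IsOrientation G D) where

  record Certificate (U : VSet n) : Set where
    field
      seeds       : VSet n
      indep       : VSet n
      seeds⊆U     : seeds ⊆ U
      indep⊆U     : indep ⊆ U
      independent : IsIndependent G indep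
      forced      : ∀ v → U v ≡ true → Forced D U seeds v
      card≤       : card seeds ≤ card indep

  open Certificate

  empty : ∀ U → (∀ w → U w ≢ true) → Certificate U
  empty U noVertex = record
    { seeds = ∅ ; indep = ∅ ; seeds⊆U = λ _ () ; indep⊆U = λ _ ()
    ; independent = λ _ _ () ; forced = λ v Uv → ⊥-elim (noVertex v Uv) ; card≤ = ≤-refl }

  extend : ∀ {U U′} (R : Certificate U′) x z → U′ ⊆ U → U x ≡ true → U z ≡ true → U′ x ≡ false →
    (∀ w → U′ w ≡ true → Adj G x w ≡ false) →
    (∀ v → U v ≡ true → Forced D U (insert z (seeds R)) v) → Certificate U
  extend R x z U′⊆U Ux Uz U′x apart forced′ = record
    { seeds = insert z (seeds R) ; indep = insert x (indep R)
    ; seeds⊆U = λ w → [ U′⊆U w ∘ seeds⊆U R w , (λ { refl → Uz }) ]′ ∘ insert-cases z (seeds R) w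
    ; indep⊆U = λ w → [ U′⊆U w ∘ indep⊆U R w , (λ { refl → Ux }) ]′ ∘ insert-cases x (indep R) w
    ; independent = insert-independent G (indep R) (independent R) x (λ w → apart w ∘ indep⊆U R w)
    ; forced = forced′
    ; card≤ = begin
        card (insert z (seeds R)) ≤⟨ card-insert z (seeds R) ⟩
        suc (card (seeds R))      ≤⟨ s≤s (card≤ R) ⟩
        suc (card (indep R))      ≤⟨ card-insert-fresh x (indep R) x∉J ⟩
        card (insert x (indep R)) ∎ }
    where
    open ≤-Reasoning
    x∉J : indep R x ≡ false
    x∉J = ¬-not λ Jx → case trans (sym (indep⊆U R x Jx)) U′x of λ ()

  arc⇒edge : ∀ u v → D u v ≡ true → Adj G v u ≡ true
  arc⇒edge u v uv = trans (Adj-sym G v u) (proj₁ orientation u v uv)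

  isolatedStep : ∀ U x → U x ≡ true → (∀ w → U w ≡ true → Adj G x w ≡ false) →
    Certificate (remove x U) → Certificate U
  isolatedStep U x Ux isolated R =
    extend R x x (remove-⊆ x U) Ux Ux (remove-self x U) (λ w → isolated w ∘ remove-⊆ x U w) forced′
    where
    S = insert x (seeds R)
    outside : ∀ w u → U w ≡ true → remove x U w ≡ false → Forced D (remove x U) (seeds R) u →
      D u w ≡ true → Forced D U S w
    outside w u Uw U′w Fu uw with refl ← remove-out x U w Uw U′w
      with () ← trans (sym (arc⇒edge u x uw)) (isolated u (remove-⊆ x U u (Forced-∈ (seeds⊆U R) Fu)))
    forced′ : ∀ v → U v ≡ true → Forced D U S v
    forced′ v Uv with v ≟F x
    ... | yes refl = seed (insert-self x (seeds R))
    ... | no v≢x = Forced-lift (remove-⊆ x U) (insert-⊇ x (seeds R)) outside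
                     (forced R v (remove-keeps x U v Uv v≢x))

  module Pendant (U : VSet n) (x y : Fin n) (Ux : U x ≡ true) (pendant : Degree≤1 G U x)
    (Uy : U y ≡ true) (xy : Adj G x y ≡ true) (R : Certificate (remove y (remove x U))) where

    U′ = remove y (remove x U)

    U′⊆U : U′ ⊆ U
    U′⊆U w = remove-⊆ x U w ∘ remove-⊆ y (remove x U) w

    U′-keeps : ∀ w → U w ≡ true → w ≢ x → w ≢ y → U′ w ≡ true
    U′-keeps w Uw w≢x w≢y = remove-keeps y (remove x U) w (remove-keeps x U w Uw w≢x) w≢y

    U′-out : ∀ w → U w ≡ true → U′ w ≡ false → w ≡ x ⊎ w ≡ y
    U′-out w Uw U′w = case w ≟F x of λ
      { (yes w≡x) → inj₁ w≡x
      ; (no w≢x) → inj₂ (remove-out y (remove x U) w (remove-keeps x U w Uw w≢x) U′w) }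

    only-y : ∀ w → U w ≡ true → Adj G x w ≡ true → w ≡ y
    only-y w Uw xw = pendant w y Uw Uy xw xy

    apart : ∀ w → U′ w ≡ true → Adj G x w ≡ false
    apart w U′w = ¬-not λ xw → remove-≢ y (remove x U) w U′w (only-y w (U′⊆U w U′w) xw)

    U′x : U′ x ≡ false
    U′x = ¬-not λ U′x → remove-≢ x U x (remove-⊆ y (remove x U) x U′x) refl

    -- Arcs can leave U′ only towards y, so y must be forced before U′ is lifted.
    module _ (z : Fin n) (Uz : U z ≡ true) (Fy : Forced D U (insert z (seeds R)) y) where

      S = insert z (seeds R)

      lift : ∀ {v} → Forced D U′ (seeds R) v → Forced D U S v
      lift = Forced-lift U′⊆U (insert-⊇ z (seeds R)) outside
        where
        outside : ∀ w u → U w ≡ true → U′ w ≡ false → Forced D U′ (seeds R) u → D u w ≡ true → Forced D U S w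
        outside w u Uw U′w Fu uw with U′-out w Uw U′w
        ... | inj₂ refl = Fy
        ... | inj₁ refl = ⊥-elim (remove-≢ y (remove x U) u U′u (only-y u (U′⊆U u U′u) (arc⇒edge u x uw)))
          where U′u = Forced-∈ (seeds⊆U R) Fu

      others : ∀ w → U w ≡ true → w ≢ x → w ≢ y → Forced D U S w
      others w Uw w≢x w≢y = lift (forced R w (U′-keeps w Uw w≢x w≢y))

      completeWith : Forced D U S x → Certificate U
      completeWith Fx = extend R x z U′⊆U Ux Uz U′x apart forced′
        where
        forced′ : ∀ v → U v ≡ true → Forced D U S v
        forced′ v Uv with v ≟F x | v ≟F y
        ... | yes refl | _ = Fx
        ... | no _ | yes refl = Fy
        ... | no v≢x | no v≢y = others v Uv v≢x v≢y

    certify : Certificate U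
    certify with proj₂ orientation x y xy
    ... | inj₁ (x→y , _) = completeWith x Ux Fy Fx
      where
      Fx = seed (insert-self x (seeds R))
      Fy = force Fx x→y Uy λ w Uw xw w≢y → ⊥-elim (w≢y (only-y w Uw (proj₁ orientation x w xw)))
    ... | inj₂ (_ , y→x) = completeWith y Uy Fy (force Fy y→x Ux λ w Uw yw w≢x → others y Uy Fy w Uw w≢x (y≢ w yw))
      where
      Fy = seed (insert-self y (seeds R))
      y≢ : ∀ w → D y w ≡ true → w ≢ y
      y≢ w yw refl with () ← trans (sym (proj₁ orientation y y yw)) (irrefl G y)

  certificate : ∀ N U → card U ≤ N → Certificate U
  certificate zero U size = empty U λ w Uw → <⇒≱ (card-pos U w Uw) size
  certificate (suc N) U size with any? (λ w → U w ≟B true)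
  ... | no noVertex = empty U λ w Uw → noVertex (w , Uw)
  ... | yes (u , Uu) with leaf G acyclic U u Uu
  ... | x , Ux , pendant with any? (λ y → (U y ≟B true) ×-dec (Adj G x y ≟B true))
  ... | no isolated = isolatedStep U x Ux (λ w Uw → ¬-not λ xw → isolated (w , Uw , xw))
                        (certificate N (remove x U) smaller)
    where
    smaller : card (remove x U) ≤ N
    smaller = s≤s⁻¹ (≤-trans (card-remove x U Ux) size)
  ... | yes (y , Uy , xy) = Pendant.certify U x y Ux pendant Uy xy
                              (certificate N (remove y (remove x U)) smaller)
    where
    smaller : card (remove y (remove x U)) ≤ N
    smaller = ≤-trans (card-mono _ _ (remove-⊆ y (remove x U))) (s≤s⁻¹ (≤-trans (card-remove x U Ux) size))

forcingSet≤independenceNumber : (G : Graph n) → 1 ≤ n → Acyclic G → ∀ D → IsOrientation G D →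
  ∀ a → IsIndependenceNumber G a → ∃ λ S → IsForcingSet D S × count S ≤ a
forcingSet≤independenceNumber {n} G 1≤n acyclic D orientation a (_ , maximum) =
  seeds , Forced⇒IsForcingSet D seeds (fromℕ< 1≤n) (λ v → forced v refl) , small
  where
  open ForestBound G acyclic D orientation
  open Certificate (certificate n full (card≤n full))
  small : count seeds ≤ a
  small = begin
    count seeds ≡⟨ count≡card seeds ⟩
    card seeds  ≤⟨ card≤ ⟩
    card indep  ≡⟨ count≡card indep ⟨
    count indep ≤⟨ maximum indep independent ⟩
    a           ∎
    where open ≤-Reasoning

decidable-threshold : (P : ℕ → Set) → (∀ k → Dec (P k)) → P 0 → ∀ m → ¬ P m → ∃ λ k → P k × ¬ P (suc k)
decidable-threshold P P? P0 zero ¬P0 = ⊥-elim (¬P0 P0)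
decidable-threshold P P? P0 (suc m) ¬Psm with P? m
... | yes Pm = m , Pm , ¬Psm
... | no ¬Pm = decidable-threshold P P? P0 m ¬Pm

independent? : (G : Graph n) (J : VSet n) → Dec (IsIndependent G J)
independent? G J = all? λ u → all? λ v → (J u ≟B true) →-dec (J v ≟B true) →-dec (Adj G u v ≟B false)

module _ (G : Graph n) where
  private
    -- Quantifying over Subset rather than VSet makes ∃ decidable (anySubset?).
    HasIndependent : ℕ → Set
    HasIndependent k = ∃ λ (S : Subset n) → IsIndependent G (lookup S) × k ≤ card (lookup S)

    HasIndependent? : ∀ k → Dec (HasIndependent k)
    HasIndependent? k = anySubset? λ S → independent? G (lookup S) ×-dec (k ≤? card (lookup S))

    fromIndependent : ∀ {J} → IsIndependent G J → ∀ {k} → k ≤ card J → HasIndependent k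
    fromIndependent {J} independent k≤card = tabulateᵥ J ,
      (λ u v Ju Jv → independent u v (trans (sym (lookup∘tabulate J u)) Ju) (trans (sym (lookup∘tabulate J v)) Jv)) ,
      ≤-trans k≤card (≤-reflexive (card-cong J _ (sym ∘ lookup∘tabulate J)))

    tooLarge : ¬ HasIndependent (suc n)
    tooLarge (S , _ , n<card) = <⇒≱ n<card (card≤n (lookup S))

  independenceNumber-exists : ∃ λ a → IsIndependenceNumber G a
  independenceNumber-exists
    with decidable-threshold HasIndependent HasIndependent? (fromIndependent {∅} (λ _ _ ()) z≤n) (suc n) tooLarge
  ... | k , (S , independent , k≤card) , ¬larger =
    k , (lookup S , independent , trans (count≡card (lookup S)) (≤-antisym card≤k k≤card)) ,
    λ J independentJ → subst (_≤ k) (sym (count≡card J)) (≮⇒≥ (¬larger ∘ fromIndependent independentJ))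
    where
    card≤k : card (lookup S) ≤ k
    card≤k = ≮⇒≥ λ k<card → ¬larger (S , independent , k<card)

IsMOF-unique : (G : Graph n) → ∀ {m m′} → IsMOF G m → IsMOF G m′ → m ≡ m′
IsMOF-unique G ((D , D-orientation , Fm) , bound) ((D′ , D′-orientation , Fm′) , bound′) =
  ≤-antisym (bound′ D D-orientation _ Fm) (bound D′ D′-orientation _ Fm′)

forcingNumber≤α : (G : Graph n) → 1 ≤ n → Acyclic G → ∀ a → IsIndependenceNumber G a →
  ∀ D → IsOrientation G D → ∀ k → IsForcingNumber D k → k ≤ a
forcingNumber≤α G 1≤n acyclic a α D orientation k (_ , minimal)
  with forcingSet≤independenceNumber G 1≤n acyclic D orientation a α
... | S , forcing , S≤a = ≤-trans (minimal S forcing) S≤a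

independentFirst-forcingNumber : (G : Graph n) → 1 ≤ n → Acyclic G → ∀ a → (α : IsIndependenceNumber G a) →
  IsForcingNumber (byRank G (independentFirst (proj₁ (proj₁ α)))) a
independentFirst-forcingNumber G 1≤n acyclic a α@((I , independent , count≡a) , _)
  with forcingSet≤independenceNumber G 1≤n acyclic _ (byRank-isOrientation G _ (independentFirst-injective I)) a α
... | S , forcing , S≤a = (S , forcing , ≤-antisym S≤a (a≤ S forcing)) , a≤
  where
  a≤ : ∀ S → IsForcingSet (byRank G (independentFirst I)) S → a ≤ count S
  a≤ S forcing = subst (_≤ count S) count≡a (count-mono I S (independent⊆forcingSet G I independent S forcing))

forest-MOF : (G : Graph n) → 1 ≤ n → Acyclic G → ∀ a → IsIndependenceNumber G a → IsMOF G a
forest-MOF G 1≤n acyclic a α@((I , _) , _) =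
  (byRank G (independentFirst I) , byRank-isOrientation G _ (independentFirst-injective I) ,
   independentFirst-forcingNumber G 1≤n acyclic a α) ,
  forcingNumber≤α G 1≤n acyclic a α

theorem3p23 : ∀ (n : ℕ) (T : Graph n) → IsTree T →
    (∀ (a : ℕ) → IsIndependenceNumber T a → IsMOF T a) ×
    (∀ (m : ℕ) → IsMOF T m → IsIndependenceNumber T m)
theorem3p23 n T (1≤n , _ , acyclic) = forest-MOF T 1≤n acyclic , MOF⇒α
  where
  MOF⇒α : ∀ m → IsMOF T m → IsIndependenceNumber T m
  MOF⇒α m mof with independenceNumber-exists T
  ... | a , α = subst (IsIndependenceNumber T) (IsMOF-unique T (forest-MOF T 1≤n acyclic a α) mof) α
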